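{- Let $n$ be an even positive integer and let $x_1,\ldots,x_n$ be independent indeterminates. Then, as an identity of rational functions, $$ (x_1\cdots x_n)^2 \sum_{k=1}^n\sum_{\substack{l=1\\ l\neq k}}^n x_k^{ -2}x_l^{ -1} \prod_{\substack{i=1\\ i\neq k}}^n \frac{1-x_ix_k}{x_i-x_k} \prod_{\substack{i=1\\ i\neq k,l}}^n \frac{1-x_ix_l}{x_i-x_l} = 1-x_1\cdots x_n.$$ -}

module Defs where

open import Data.Nat using (ℕ; zero; suc)
open import Data.Fin using (Fin; zero; suc)
open import Data.Rational using (ℚ; 0ℚ; 1ℚ; _+_; _*_; _-_; 1/_; ≢-nonZero)
open import Data.Rational.Properties using (_≟_)
import Data.Fin as F
open import Relation.Nullary using (yes; no)

-- Total inverse on ℚ: 1/q for q ≠ 0, and 0 at 0 (only ever applied to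
-- nonzero arguments in the statement, under its hypotheses).
inv : ℚ → ℚ
inv q with q ≟ 0ℚ
... | yes _ = 0ℚ
... | no q≢0 = 1/_ q {{≢-nonZero q≢0}}

sumF : ∀ {n} → (Fin n → ℚ) → ℚ
sumF {zero} f = 0ℚ
sumF {suc n} f = f zero + sumF (λ i → f (suc i))

prodF : ∀ {n} → (Fin n → ℚ) → ℚ
prodF {zero} f = 1ℚ
prodF {suc n} f = f zero * prodF (λ i → f (suc i))

sumExcept : ∀ {n} → Fin n → (Fin n → ℚ) → ℚ
sumExcept k f = sumF (λ i → ifneq i)
  where
  ifneq : _ → ℚ
  ifneq i with i F.≟ k
  ... | yes _ = 0ℚ
  ... | no _ = f i

prodExcept : ∀ {n} → Fin n → (Fin n → ℚ) → ℚ
prodExcept k f = prodF (λ i → ifneq i)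
  where
  ifneq : _ → ℚ
  ifneq i with i F.≟ k
  ... | yes _ = 1ℚ
  ... | no _ = f i

prodExcept2 : ∀ {n} → Fin n → Fin n → (Fin n → ℚ) → ℚ
prodExcept2 k l f = prodExcept k (λ i → ifneq i)
  where
  ifneq : _ → ℚ
  ifneq i with i F.≟ l
  ... | yes _ = 1ℚ
  ... | no _ = f i

lhs : ∀ {n} → (Fin n → ℚ) → ℚ
lhs x =
  (prodF x * prodF x) *
  sumF (λ k → sumExcept k (λ l →
     inv (x k * x k) * inv (x l) *
     prodExcept k (λ i → (1ℚ - x i * x k) * inv (x i - x k)) *
     prodExcept2 k l (λ i → (1ℚ - x i * x l) * inv (x i - x l))))

{-# OPTIONS --safe #-}
-- For distinct y₁, …, yₙ put R(z) = ∏ᵢ (1 − yᵢz)/(yᵢ − z) and wₗ = ∏_{i≠l} (1 − yᵢyₗ)/(yᵢ − yₗ).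
-- The partial fraction expansion of R reads
--   (1 − z²) Σₗ wₗ/(yₗ − z) = R(z) − [n even] + [n odd]·z .
-- It is proved by induction on n: with a = y₁, the factor (1 − at)/((a − t)(t − z)) of the summand
-- at t = yₗ splits into simple fractions in t with poles a and z, which expresses the sum for
-- y₁, …, yₙ through the sums for y₂, …, yₙ at z and at a.
-- At z = 0 the expansion gives Σₗ wₗ/yₗ = ∏ᵢ 1/yᵢ − [n even].
-- In the theorem, for fixed k the product over i ∉ {k, l} is the weight of l in the family with xₖ
-- removed, which has odd size; so the inner sum is ∏_{i≠k} 1/xᵢ, the k-th term is P wₖ/xₖ with
-- P = x₁⋯xₙ, and the outer sum over the even family is P (1/P − 1) = 1 − P.
module Submission where

open import Defs
open import Data.Nat using (ℕ; _≤_)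
open import Data.Nat.Divisibility using (_∣_)
open import Data.Fin using (Fin)
open import Data.Rational using (ℚ; 0ℚ; 1ℚ; _-_)
open import Relation.Binary.PropositionalEquality using (_≡_; _≢_)

open import Algebra.Bundles using (CommutativeMonoid; CommutativeRing)
import Algebra.Properties.CommutativeMonoid.Sum as MonoidSum
open import Data.Nat using (zero; suc)
open import Data.Fin using (zero; suc; punchIn)
import Data.Fin as Fin
open import Data.Fin.Properties using (0≢1+n; suc-injective; punchInᵢ≢i; punchIn-injective)
import Data.Nat as ℕ
open import Data.Nat.Divisibility using (divides)
open import Data.Rational using (_+_; _*_; ≢-nonZero)
import Data.Rational.Properties as ℚ
open import Data.Vec.Functional using (removeAt; replicate)
open import Function using (_∘_; Injective)
open import Level using (0ℓ)
open import Relation.Binary.PropositionalEquality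
  using (refl; sym; trans; cong; cong₂; ≡-≟-identity; ≢-≟-identity; module ≡-Reasoning)
open import Relation.Nullary using (yes; no; contradiction)
open import Relation.Nullary.Decidable using (dec⇒maybe; decidable-stable)
open import Tactic.RingSolver using (solve-∀)
open import Tactic.RingSolver.Core.AlmostCommutativeRing
  using (AlmostCommutativeRing; fromCommutativeRing)

open import Algebra.Properties.Group ℚ.+-0-group using (x∙y⁻¹≈ε⇒x≈y)
open import Algebra.Properties.Semiring.Sum (CommutativeRing.semiring ℚ.+-*-commutativeRing)
  using (sum-cong-≗; ∑-distrib-+; *-distribˡ-sum) renaming (sum to ∑)
open MonoidSum (CommutativeRing.*-commutativeMonoid ℚ.+-*-commutativeRing)
  using () renaming (sum to ∏; sum-cong-≗ to ∏-cong-≗; sum-remove to ∏-remove;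
                     ∑-distrib-+ to ∏-distrib-*; sum-replicate-zero to ∏-replicate-1)

-- The zero test lets the solver drop cancelled monomials, which it needs to match normal forms.
ℚ-ring : AlmostCommutativeRing 0ℓ 0ℓ
ℚ-ring = fromCommutativeRing ℚ.+-*-commutativeRing (λ q → dec⇒maybe (0ℚ ℚ.≟ q))

module _ {c ℓ} (M : CommutativeMonoid c ℓ) where
  open CommutativeMonoid M
  open MonoidSum M
  open import Relation.Binary.Reasoning.Setoid setoid

  sum-removeAt : ∀ {n} (k : Fin (suc n)) {g : Fin (suc n) → Carrier} f →
                 g k ≈ ε → (∀ i → i ≢ k → g i ≈ f i) → sum g ≈ sum (removeAt f k)
  sum-removeAt k {g} f gk≈ε g≈f = begin
    sum g                     ≈⟨ sum-remove {i = k} g ⟩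
    g k ∙ sum (removeAt g k)  ≈⟨ ∙-cong gk≈ε (sum-cong-≋ λ j → g≈f _ (punchInᵢ≢i k j)) ⟩
    ε ∙ sum (removeAt f k)    ≈⟨ identityˡ _ ⟩
    sum (removeAt f k)        ∎

open ≡-Reasoning

∑-removeAt : ∀ {n} (k : Fin (suc n)) {g : Fin (suc n) → ℚ} f →
             g k ≡ 0ℚ → (∀ i → i ≢ k → g i ≡ f i) → ∑ g ≡ ∑ (removeAt f k)
∑-removeAt = sum-removeAt (CommutativeRing.+-commutativeMonoid ℚ.+-*-commutativeRing)

∏-removeAt : ∀ {n} (k : Fin (suc n)) {g : Fin (suc n) → ℚ} f →
             g k ≡ 1ℚ → (∀ i → i ≢ k → g i ≡ f i) → ∏ g ≡ ∏ (removeAt f k)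
∏-removeAt = sum-removeAt (CommutativeRing.*-commutativeMonoid ℚ.+-*-commutativeRing)

sumF≡∑ : ∀ {n} (f : Fin n → ℚ) → sumF f ≡ ∑ f
sumF≡∑ {zero}  f = refl
sumF≡∑ {suc n} f = cong (f zero +_) (sumF≡∑ (f ∘ suc))

prodF≡∏ : ∀ {n} (f : Fin n → ℚ) → prodF f ≡ ∏ f
prodF≡∏ {zero}  f = refl
prodF≡∏ {suc n} f = cong (f zero *_) (prodF≡∏ (f ∘ suc))

-- `sumExcept`, `prodExcept` and `prodExcept2` fold anonymous `with`-functions, which cannot
-- be named directly; solving `b ≡ F a` by `refl` recovers the argument `a` of the fold.
argumentOf : ∀ {A B : Set} (F : A → B) (b : B) {a : A} → b ≡ F a → A
argumentOf _ _ {a} _ = a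

exceptTerm : ∀ {n} → Fin n → (Fin n → ℚ) → Fin n → ℚ
exceptTerm k f = argumentOf sumF (sumExcept k f) refl

exceptFactor : ∀ {n} → Fin n → (Fin n → ℚ) → Fin n → ℚ
exceptFactor k f = argumentOf prodF (prodExcept k f) refl

exceptFactor₂ : ∀ {n} → Fin n → Fin n → (Fin n → ℚ) → Fin n → ℚ
exceptFactor₂ k l f = argumentOf (prodExcept k) (prodExcept2 k l f) refl

exceptTerm-at : ∀ {n} (k : Fin n) f → exceptTerm k f k ≡ 0ℚ
exceptTerm-at k f rewrite ≡-≟-identity Fin._≟_ {k} refl = refl

exceptTerm-off : ∀ {n} (k : Fin n) f i → i ≢ k → exceptTerm k f i ≡ f i
exceptTerm-off k f i i≢k rewrite ≢-≟-identity Fin._≟_ i≢k = refl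

exceptFactor-at : ∀ {n} (k : Fin n) f → exceptFactor k f k ≡ 1ℚ
exceptFactor-at k f rewrite ≡-≟-identity Fin._≟_ {k} refl = refl

exceptFactor-off : ∀ {n} (k : Fin n) f i → i ≢ k → exceptFactor k f i ≡ f i
exceptFactor-off k f i i≢k rewrite ≢-≟-identity Fin._≟_ i≢k = refl

exceptFactor₂-at : ∀ {n} (k l : Fin n) f → exceptFactor₂ k l f l ≡ 1ℚ
exceptFactor₂-at k l f rewrite ≡-≟-identity Fin._≟_ {l} refl = refl

exceptFactor₂-off : ∀ {n} (k l : Fin n) f i → i ≢ l → exceptFactor₂ k l f i ≡ f i
exceptFactor₂-off k l f i i≢l rewrite ≢-≟-identity Fin._≟_ i≢l = refl

sumExcept≡∑-removeAt : ∀ {n} (k : Fin (suc n)) f → sumExcept k f ≡ ∑ (removeAt f k)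
sumExcept≡∑-removeAt k f =
  trans (sumF≡∑ (exceptTerm k f)) (∑-removeAt k f (exceptTerm-at k f) (exceptTerm-off k f))

prodExcept≡∏-removeAt : ∀ {n} (k : Fin (suc n)) f → prodExcept k f ≡ ∏ (removeAt f k)
prodExcept≡∏-removeAt k f =
  trans (prodF≡∏ (exceptFactor k f)) (∏-removeAt k f (exceptFactor-at k f) (exceptFactor-off k f))

prodExcept2≡∏-removeAt² : ∀ {n} (k : Fin (suc (suc n))) j f →
                          prodExcept2 k (punchIn k j) f ≡ ∏ (removeAt (removeAt f k) j)
prodExcept2≡∏-removeAt² k j f =
  trans (prodExcept≡∏-removeAt k (exceptFactor₂ k l f))
        (∏-removeAt j (removeAt f k) (exceptFactor₂-at k l f) off)
  where
  l = punchIn k j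
  off : ∀ i → i ≢ j → exceptFactor₂ k l f (punchIn k i) ≡ f (punchIn k i)
  off i i≢j = exceptFactor₂-off k l f (punchIn k i) (i≢j ∘ punchIn-injective k i j)

*-inv : ∀ {q} → q ≢ 0ℚ → q * inv q ≡ 1ℚ
*-inv {q} q≢0 with q ℚ.≟ 0ℚ
... | yes q≡0  = contradiction q≡0 q≢0
... | no  q≢0′ = ℚ.*-inverseʳ q {{≢-nonZero q≢0′}}

sub-*-inv : ∀ {p q} → p ≢ q → (p - q) * inv (p - q) ≡ 1ℚ
sub-*-inv {p} {q} p≢q = *-inv (p≢q ∘ x∙y⁻¹≈ε⇒x≈y p q)

inv-unique : ∀ {p q} → p * q ≡ 1ℚ → inv p ≡ q
inv-unique {p} {q} pq≡1 = begin
  inv p            ≡⟨ sym (ℚ.*-identityʳ (inv p)) ⟩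
  inv p * 1ℚ       ≡⟨ cong (inv p *_) (sym pq≡1) ⟩
  inv p * (p * q)  ≡⟨ rearrange (inv p) p q ⟩
  p * inv p * q    ≡⟨ cong (_* q) (*-inv p≢0) ⟩
  1ℚ * q           ≡⟨ ℚ.*-identityˡ q ⟩
  q                ∎
  where
  p≢0 : p ≢ 0ℚ
  p≢0 refl = ℚ.1≢0 (trans (sym pq≡1) (ℚ.*-zeroˡ q))
  rearrange : ∀ a b c → a * (b * c) ≡ b * a * c
  rearrange = solve-∀ ℚ-ring

inv-distrib-* : ∀ {p q} → p ≢ 0ℚ → q ≢ 0ℚ → inv (p * q) ≡ inv p * inv q
inv-distrib-* {p} {q} p≢0 q≢0 = inv-unique {p * q} (begin
  p * q * (inv p * inv q)    ≡⟨ rearrange p q (inv p) (inv q) ⟩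
  p * inv p * (q * inv q)    ≡⟨ cong₂ _*_ (*-inv p≢0) (*-inv q≢0) ⟩
  1ℚ                         ∎)
  where
  rearrange : ∀ a b c d → a * b * (c * d) ≡ a * c * (b * d)
  rearrange = solve-∀ ℚ-ring

∏-inverse : ∀ {n} (y : Fin n → ℚ) → (∀ i → y i ≢ 0ℚ) → ∏ y * ∏ (inv ∘ y) ≡ 1ℚ
∏-inverse {n} y y≢0 = begin
  ∏ y * ∏ (inv ∘ y)            ≡⟨ sym (∏-distrib-* y (inv ∘ y)) ⟩
  ∏ (λ i → y i * inv (y i))    ≡⟨ ∏-cong-≗ (λ i → *-inv (y≢0 i)) ⟩
  ∏ (replicate n 1ℚ)           ≡⟨ ∏-replicate-1 n ⟩
  1ℚ                           ∎

∏*∏inv-removeAt : ∀ {n} (y : Fin (suc n) → ℚ) → (∀ i → y i ≢ 0ℚ) → ∀ k →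
                  ∏ y * ∏ (inv ∘ removeAt y k) ≡ y k
∏*∏inv-removeAt y y≢0 k = begin
  ∏ y * ∏ (inv ∘ y′)            ≡⟨ cong (_* ∏ (inv ∘ y′)) (∏-remove {i = k} y) ⟩
  y k * ∏ y′ * ∏ (inv ∘ y′)     ≡⟨ ℚ.*-assoc (y k) (∏ y′) (∏ (inv ∘ y′)) ⟩
  y k * (∏ y′ * ∏ (inv ∘ y′))   ≡⟨ cong (y k *_) (∏-inverse y′ (y≢0 ∘ punchIn k)) ⟩
  y k * 1ℚ                      ≡⟨ ℚ.*-identityʳ (y k) ⟩
  y k                           ∎
  where y′ = removeAt y k

evenIndicator : ℕ → ℚ
evenIndicator zero          = 1ℚ
evenIndicator (suc zero)    = 0ℚ
evenIndicator (suc (suc n)) = evenIndicator n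

evenIndicator-even : ∀ q → evenIndicator (q ℕ.* 2) ≡ 1ℚ
evenIndicator-even zero    = refl
evenIndicator-even (suc q) = evenIndicator-even q

evenIndicator-odd : ∀ q → evenIndicator (suc (q ℕ.* 2)) ≡ 0ℚ
evenIndicator-odd zero    = refl
evenIndicator-odd (suc q) = evenIndicator-odd q

ratio : ℚ → ℚ → ℚ
ratio a b = (1ℚ - a * b) * inv (a - b)

ratio-zeroʳ : ∀ a → ratio a 0ℚ ≡ inv a
ratio-zeroʳ a = begin
  (1ℚ - a * 0ℚ) * inv (a - 0ℚ)
    ≡⟨ cong₂ (λ b c → (1ℚ - b) * inv c) (ℚ.*-zeroʳ a) (ℚ.+-identityʳ a) ⟩
  1ℚ * inv a                    ≡⟨ ℚ.*-identityˡ (inv a) ⟩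
  inv a                         ∎

ratio-partial-fractions : ∀ {a t z} → a ≢ t → a ≢ z → t ≢ z →
  ratio a t * inv (t - z) ≡ ratio a z * inv (t - z) + (a * a - 1ℚ) * inv (a - z) * inv (t - a)
ratio-partial-fractions {a} {t} {z} a≢t a≢z t≢z = begin
  L                                      ≡⟨ sym (*1*1 L) ⟩
  L * 1ℚ * 1ℚ
    ≡⟨ cong₂ (λ c d → L * c * d) (sym (sub-*-inv a≢z)) (sym (sub-*-inv t≢a)) ⟩
  L * ((a - z) * v) * ((t - a) * r)
    ≡⟨ clear-denominators a t z p w v r ⟩
  T₁ * ((a - t) * p) * ((t - a) * r) + T₂ * ((a - t) * p) * ((t - z) * w)
    ≡⟨ cong₂ _+_ (cong₂ (λ c d → T₁ * c * d) (sub-*-inv a≢t) (sub-*-inv t≢a))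
                 (cong₂ (λ c d → T₂ * c * d) (sub-*-inv a≢t) (sub-*-inv t≢z)) ⟩
  T₁ * 1ℚ * 1ℚ + T₂ * 1ℚ * 1ℚ           ≡⟨ cong₂ _+_ (*1*1 T₁) (*1*1 T₂) ⟩
  T₁ + T₂                                ∎
  where
  p = inv (a - t); w = inv (t - z); v = inv (a - z); r = inv (t - a)
  t≢a = a≢t ∘ sym
  L = (1ℚ - a * t) * p * w
  T₁ = (1ℚ - a * z) * v * w
  T₂ = (a * a - 1ℚ) * v * r
  *1*1 : ∀ x → x * 1ℚ * 1ℚ ≡ x
  *1*1 x = trans (ℚ.*-identityʳ (x * 1ℚ)) (ℚ.*-identityʳ x)
  clear-denominators : ∀ a t z p w v r →
    (1ℚ - a * t) * p * w * ((a - z) * v) * ((t - a) * r) ≡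
    (1ℚ - a * z) * v * w * ((a - t) * p) * ((t - a) * r) +
    (a * a - 1ℚ) * v * r * ((a - t) * p) * ((t - z) * w)
  clear-denominators = solve-∀ ℚ-ring

weight : ∀ {n} → (Fin n → ℚ) → Fin n → ℚ
weight {suc n} y l = ∏ (removeAt (λ i → ratio (y i) (y l)) l)

weight-suc : ∀ {n} (y : Fin (suc n) → ℚ) l →
             weight y (suc l) ≡ ratio (y zero) (y (suc l)) * weight (y ∘ suc) l
weight-suc {suc n} y l = refl

poleSum : ∀ {n} → (Fin n → ℚ) → ℚ → ℚ
poleSum y z = ∑ (λ l → weight y l * inv (y l - z))

poleSum-suc : ∀ {n} (y : Fin (suc n) → ℚ) z → Injective _≡_ _≡_ y → (∀ i → y i ≢ z) →
  let a = y zero; y′ = y ∘ suc; v = inv (a - z) in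
  poleSum y z ≡ ∏ (λ i → ratio (y′ i) a) * v +
                (ratio a z * poleSum y′ z + (a * a - 1ℚ) * v * poleSum y′ a)
poleSum-suc {n} y z inj y≢z = cong (∏ (λ i → ratio (y′ i) a) * inv (a - z) +_) (begin
  ∑ (λ l → weight y (suc l) * inv (y′ l - z))
    ≡⟨ sum-cong-≗ split ⟩
  ∑ (λ l → ratio a z * termᶻ l + c * termᵃ l)
    ≡⟨ ∑-distrib-+ (λ l → ratio a z * termᶻ l) (λ l → c * termᵃ l) ⟩
  ∑ (λ l → ratio a z * termᶻ l) + ∑ (λ l → c * termᵃ l)
    ≡⟨ sym (cong₂ _+_ (*-distribˡ-sum (ratio a z) termᶻ) (*-distribˡ-sum c termᵃ)) ⟩
  ratio a z * ∑ termᶻ + c * ∑ termᵃ ∎)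
  where
  a = y zero
  y′ = y ∘ suc
  c = (a * a - 1ℚ) * inv (a - z)
  termᶻ termᵃ : Fin n → ℚ
  termᶻ l = weight y′ l * inv (y′ l - z)
  termᵃ l = weight y′ l * inv (y′ l - a)
  split : ∀ l → weight y (suc l) * inv (y′ l - z) ≡ ratio a z * termᶻ l + c * termᵃ l
  split l = begin
    weight y (suc l) * inv (t - z)
      ≡⟨ cong (_* inv (t - z)) (weight-suc y l) ⟩
    ratio a t * w * inv (t - z)
      ≡⟨ rearrange (ratio a t) w (inv (t - z)) ⟩
    w * (ratio a t * inv (t - z))
      ≡⟨ cong (w *_) (ratio-partial-fractions a≢t (y≢z zero) (y≢z (suc l))) ⟩
    w * (ratio a z * inv (t - z) + c * inv (t - a))
      ≡⟨ distribute w (ratio a z) (inv (t - z)) c (inv (t - a)) ⟩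
    ratio a z * (w * inv (t - z)) + c * (w * inv (t - a)) ∎
    where
    t = y′ l
    w = weight y′ l
    a≢t : a ≢ t
    a≢t e = 0≢1+n (inj e)
    rearrange : ∀ r w i → r * w * i ≡ w * (r * i)
    rearrange = solve-∀ ℚ-ring
    distribute : ∀ w r i c j → w * (r * i + c * j) ≡ r * (w * i) + c * (w * j)
    distribute = solve-∀ ℚ-ring

partial-fractions : ∀ n (y : Fin n → ℚ) z → Injective _≡_ _≡_ y → (∀ i → y i ≢ z) →
  (1ℚ - z * z) * poleSum y z ≡ ∏ (λ i → ratio (y i) z) - evenIndicator n + evenIndicator (suc n) * z
partial-fractions zero y z _ _ = empty z
  where
  empty : ∀ z → (1ℚ - z * z) * 0ℚ ≡ 1ℚ - 1ℚ + 0ℚ * z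
  empty = solve-∀ ℚ-ring
partial-fractions (suc n) y z inj y≢z = begin
  (1ℚ - z * z) * poleSum y z
    ≡⟨ cong ((1ℚ - z * z) *_) (poleSum-suc y z inj y≢z) ⟩
  (1ℚ - z * z) * (R′ a * v + (ratio a z * S′ z + (a * a - 1ℚ) * v * S′ a))
    ≡⟨ expand z a v (R′ a) (S′ z) (S′ a) ⟩
  (1ℚ - z * z) * v * R′ a + ratio a z * ((1ℚ - z * z) * S′ z)
                          - (1ℚ - z * z) * v * ((1ℚ - a * a) * S′ a)
    ≡⟨ cong₂ (λ s s′ → (1ℚ - z * z) * v * R′ a + ratio a z * s - (1ℚ - z * z) * v * s′) IH-z IH-a ⟩
  (1ℚ - z * z) * v * R′ a + ratio a z * (R′ z - E + O * z)
                          - (1ℚ - z * z) * v * (R′ a - E + O * a)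
    ≡⟨ collect z a v (R′ a) (R′ z) E O ⟩
  ratio a z * R′ z + (a - z) * v * (E * z - O)
    ≡⟨ cong (λ c → ratio a z * R′ z + c * (E * z - O)) (sub-*-inv (y≢z zero)) ⟩
  ratio a z * R′ z + 1ℚ * (E * z - O)
    ≡⟨ tidy (ratio a z * R′ z) E O z ⟩
  ratio a z * R′ z - O + E * z ∎
  where
  a = y zero
  y′ = y ∘ suc
  v = inv (a - z)
  E = evenIndicator n
  O = evenIndicator (suc n)
  R′ S′ : ℚ → ℚ
  R′ w = ∏ (λ i → ratio (y′ i) w)
  S′ = poleSum y′
  inj′ : Injective _≡_ _≡_ y′
  inj′ e = suc-injective (inj e)
  IH-z = partial-fractions n y′ z inj′ (y≢z ∘ suc)
  IH-a = partial-fractions n y′ a inj′ (λ i e → 0≢1+n (inj (sym e)))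
  expand : ∀ z a v Ra Sz Sa →
    (1ℚ - z * z) * (Ra * v + ((1ℚ - a * z) * v * Sz + (a * a - 1ℚ) * v * Sa)) ≡
    (1ℚ - z * z) * v * Ra + (1ℚ - a * z) * v * ((1ℚ - z * z) * Sz)
                          - (1ℚ - z * z) * v * ((1ℚ - a * a) * Sa)
  expand = solve-∀ ℚ-ring
  collect : ∀ z a v Ra Rz E O →
    (1ℚ - z * z) * v * Ra + (1ℚ - a * z) * v * (Rz - E + O * z)
                          - (1ℚ - z * z) * v * (Ra - E + O * a) ≡
    (1ℚ - a * z) * v * Rz + (a - z) * v * (E * z - O)
  collect = solve-∀ ℚ-ring
  tidy : ∀ r E O z → r + 1ℚ * (E * z - O) ≡ r - O + E * z
  tidy = solve-∀ ℚ-ring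

∑-inv*weight : ∀ n (y : Fin n → ℚ) → Injective _≡_ _≡_ y → (∀ i → y i ≢ 0ℚ) →
               ∑ (λ l → inv (y l) * weight y l) ≡ ∏ (inv ∘ y) - evenIndicator n
∑-inv*weight n y inj y≢0 = begin
  ∑ (λ l → inv (y l) * weight y l)
    ≡⟨ sum-cong-≗ (λ l → ℚ.*-comm (inv (y l)) (weight y l)) ⟩
  ∑ (λ l → weight y l * inv (y l))
    ≡⟨ sum-cong-≗ (λ l → cong (λ d → weight y l * inv d) (sym (ℚ.+-identityʳ (y l)))) ⟩
  poleSum y 0ℚ
    ≡⟨ sym (ℚ.*-identityˡ (poleSum y 0ℚ)) ⟩
  (1ℚ - 0ℚ * 0ℚ) * poleSum y 0ℚ
    ≡⟨ partial-fractions n y 0ℚ inj y≢0 ⟩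
  ∏ (λ i → ratio (y i) 0ℚ) - E + O * 0ℚ
    ≡⟨ cong₂ (λ P c → P - E + c) (∏-cong-≗ (ratio-zeroʳ ∘ y)) (ℚ.*-zeroʳ O) ⟩
  ∏ (inv ∘ y) - E + 0ℚ
    ≡⟨ ℚ.+-identityʳ (∏ (inv ∘ y) - E) ⟩
  ∏ (inv ∘ y) - E ∎
  where
  E = evenIndicator n
  O = evenIndicator (suc n)

∑-inv*weight-odd : ∀ q (y : Fin (suc (q ℕ.* 2)) → ℚ) → Injective _≡_ _≡_ y → (∀ i → y i ≢ 0ℚ) →
                   ∑ (λ l → inv (y l) * weight y l) ≡ ∏ (inv ∘ y)
∑-inv*weight-odd q y inj y≢0 = begin
  ∑ (λ l → inv (y l) * weight y l)              ≡⟨ ∑-inv*weight _ y inj y≢0 ⟩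
  ∏ (inv ∘ y) - evenIndicator (suc (q ℕ.* 2))   ≡⟨ cong (λ e → ∏ (inv ∘ y) - e) (evenIndicator-odd q) ⟩
  ∏ (inv ∘ y) - 0ℚ                              ≡⟨ ℚ.+-identityʳ (∏ (inv ∘ y)) ⟩
  ∏ (inv ∘ y)                                   ∎

∑-inv*weight-even : ∀ q (y : Fin (q ℕ.* 2) → ℚ) → Injective _≡_ _≡_ y → (∀ i → y i ≢ 0ℚ) →
                    ∑ (λ l → inv (y l) * weight y l) ≡ ∏ (inv ∘ y) - 1ℚ
∑-inv*weight-even q y inj y≢0 =
  trans (∑-inv*weight _ y inj y≢0) (cong (λ e → ∏ (inv ∘ y) - e) (evenIndicator-even q))

lhs≡∑∑ : ∀ {m} (x : Fin (suc (suc m)) → ℚ) →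
  lhs x ≡ ∏ x * ∏ x * ∑ (λ k → inv (x k * x k) * weight x k *
                              ∑ (λ j → inv (removeAt x k j) * weight (removeAt x k) j))
lhs≡∑∑ {m} x = cong₂ _*_ (cong₂ _*_ (prodF≡∏ x) (prodF≡∏ x)) (begin
  sumF (λ k → sumExcept k (term k))   ≡⟨ sumF≡∑ (λ k → sumExcept k (term k)) ⟩
  ∑ (λ k → sumExcept k (term k))      ≡⟨ sum-cong-≗ inner ⟩
  ∑ (λ k → c k * ∑ (d k))             ∎)
  where
  x′ = removeAt x
  ratioTo : ℚ → Fin (suc (suc m)) → ℚ
  ratioTo b i = ratio (x i) b
  term : Fin (suc (suc m)) → Fin (suc (suc m)) → ℚ
  term k l = inv (x k * x k) * inv (x l) * prodExcept k (ratioTo (x k)) * prodExcept2 k l (ratioTo (x l))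
  c : Fin (suc (suc m)) → ℚ
  c k = inv (x k * x k) * weight x k
  d : Fin (suc (suc m)) → Fin (suc m) → ℚ
  d k j = inv (x′ k j) * weight (x′ k) j
  factor : ∀ k j → term k (punchIn k j) ≡ c k * d k j
  factor k j = begin
    term k (punchIn k j)
      ≡⟨ cong₂ (λ P P′ → inv (x k * x k) * inv (x′ k j) * P * P′)
               (prodExcept≡∏-removeAt k (ratioTo (x k))) (prodExcept2≡∏-removeAt² k j (ratioTo (x′ k j))) ⟩
    inv (x k * x k) * inv (x′ k j) * weight x k * weight (x′ k) j
      ≡⟨ rearrange (inv (x k * x k)) (inv (x′ k j)) (weight x k) (weight (x′ k) j) ⟩
    c k * d k j ∎
    where
    rearrange : ∀ a b c d → a * b * c * d ≡ a * c * (b * d)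
    rearrange = solve-∀ ℚ-ring
  inner : ∀ k → sumExcept k (term k) ≡ c k * ∑ (d k)
  inner k = begin
    sumExcept k (term k)             ≡⟨ sumExcept≡∑-removeAt k (term k) ⟩
    ∑ (λ j → term k (punchIn k j))   ≡⟨ sum-cong-≗ (factor k) ⟩
    ∑ (λ j → c k * d k j)            ≡⟨ sym (*-distribˡ-sum (c k) (d k)) ⟩
    c k * ∑ (d k)                    ∎

∏²-cancel-removeAt : ∀ {n} (y : Fin (suc n) → ℚ) → (∀ i → y i ≢ 0ℚ) → ∀ k w →
  ∏ y * ∏ y * (inv (y k * y k) * w * ∏ (inv ∘ removeAt y k)) ≡ ∏ y * (inv (y k) * w)
∏²-cancel-removeAt y y≢0 k w = begin
  P * P * (inv (y k * y k) * w * Q)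
    ≡⟨ cong (λ i → P * P * (i * w * Q)) (inv-distrib-* (y≢0 k) (y≢0 k)) ⟩
  P * P * (inv (y k) * inv (y k) * w * Q)
    ≡⟨ rearrange P (inv (y k)) w Q ⟩
  P * (inv (y k) * w) * (P * Q * inv (y k))
    ≡⟨ cong (λ c → P * (inv (y k) * w) * (c * inv (y k))) (∏*∏inv-removeAt y y≢0 k) ⟩
  P * (inv (y k) * w) * (y k * inv (y k))
    ≡⟨ cong (P * (inv (y k) * w) *_) (*-inv (y≢0 k)) ⟩
  P * (inv (y k) * w) * 1ℚ
    ≡⟨ ℚ.*-identityʳ (P * (inv (y k) * w)) ⟩
  P * (inv (y k) * w) ∎
  where
  P = ∏ y
  Q = ∏ (inv ∘ removeAt y k)
  rearrange : ∀ p i w q → p * p * (i * i * w * q) ≡ p * (i * w) * (p * q * i)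
  rearrange = solve-∀ ℚ-ring

lhs≡∏*∑inv*weight : ∀ q (x : Fin (suc q ℕ.* 2) → ℚ) → Injective _≡_ _≡_ x → (∀ i → x i ≢ 0ℚ) →
                    lhs x ≡ ∏ x * ∑ (λ k → inv (x k) * weight x k)
lhs≡∏*∑inv*weight q x inj x≢0 = begin
  lhs x
    ≡⟨ lhs≡∑∑ x ⟩
  P * P * ∑ (λ k → c k * ∑ (λ j → inv (x′ k j) * weight (x′ k) j))
    ≡⟨ cong (P * P *_) (sum-cong-≗ λ k → cong (c k *_) (∑-inv*weight-odd q (x′ k) (inj′ k) (x≢0 ∘ punchIn k))) ⟩
  P * P * ∑ (λ k → c k * ∏ (inv ∘ x′ k))
    ≡⟨ *-distribˡ-sum (P * P) (λ k → c k * ∏ (inv ∘ x′ k)) ⟩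
  ∑ (λ k → P * P * (c k * ∏ (inv ∘ x′ k)))
    ≡⟨ sum-cong-≗ (λ k → ∏²-cancel-removeAt x x≢0 k (weight x k)) ⟩
  ∑ (λ k → P * (inv (x k) * weight x k))
    ≡⟨ sym (*-distribˡ-sum P (λ k → inv (x k) * weight x k)) ⟩
  P * ∑ (λ k → inv (x k) * weight x k) ∎
  where
  P = ∏ x
  x′ = removeAt x
  c : Fin (suc q ℕ.* 2) → ℚ
  c k = inv (x k * x k) * weight x k
  inj′ : ∀ k → Injective _≡_ _≡_ (x′ k)
  inj′ k e = punchIn-injective k _ _ (inj e)

lemma2 : (n : ℕ) → 2 ∣ n → 1 ≤ n → (x : Fin n → ℚ) →
    (∀ i → x i ≢ 0ℚ) → (∀ i j → i ≢ j → x i ≢ x j) →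
    lhs x ≡ 1ℚ - prodF x
lemma2 _ (divides zero refl) ()
lemma2 _ (divides (suc q) refl) _ x x≢0 distinct = begin
  lhs x                                 ≡⟨ lhs≡∏*∑inv*weight q x inj x≢0 ⟩
  P * ∑ (λ k → inv (x k) * weight x k)  ≡⟨ cong (P *_) (∑-inv*weight-even (suc q) x inj x≢0) ⟩
  P * (∏ (inv ∘ x) - 1ℚ)                ≡⟨ distrib P (∏ (inv ∘ x)) ⟩
  P * ∏ (inv ∘ x) - P                   ≡⟨ cong (_- P) (∏-inverse x x≢0) ⟩
  1ℚ - P                                ≡⟨ cong (1ℚ -_) (sym (prodF≡∏ x)) ⟩
  1ℚ - prodF x                          ∎
  where
  P = ∏ x
  inj : Injective _≡_ _≡_ x
  inj {i} {j} xi≡xj = decidable-stable (i Fin.≟ j) (λ i≢j → distinct i j i≢j xi≡xj)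
  distrib : ∀ p r → p * (r - 1ℚ) ≡ p * r - p
  distrib = solve-∀ ℚ-ring
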